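{- Let $n,k,\ell$ be positive integers with $1\le k\le n/2$, and let $\pi=(1^{c_1},\ldots,n^{c_n})$ be an integer partition of $n$. Let $\Gamma$ be any graph on vertex set $\{1,\ldots,n\}$ whose connected components have sizes given by $\pi$, and let $f_\pi^\ell$ be the number of $\ell$-tuples $(\alpha_1,\ldots,\alpha_\ell)$ of $k$-subsets of $\{1,\ldots,n\}$ such that each $\alpha_m$ is fixed setwise by every transposition $(i\,j)$ with $\{i,j\}$ an edge of $\Gamma$. Then \[ f_\pi^\ell=\left(\sum_{\substack{\eta\text{ partition of }k\\ \eta=(1^{b_1},\ldots,k^{b_k})}}\prod_{j=1}^k\binom{c_j}{b_j}\right)^{\ell}. \]
   Context: Partitions are written in exponential notation: $(1^{c_1},\ldots,n^{c_n})$ has $c_i$ parts equal to $i$, and similarly $\eta=(1^{b_1},\ldots,k^{b_k})$ has $b_j$ parts equal to $j$. The sum runs over all partitions $\eta$ of $k$, and $\binom{c}{b}=0$ when $b>c$. -}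

module Defs where

open import Data.Nat using (ℕ; zero; suc; _+_; _*_; _<?_)
import Data.Nat as ℕ
open import Data.Nat.Combinatorics using (_C_)
open import Data.Bool using (Bool; true; false; T)
import Data.Bool
import Data.Bool.Properties as BoolP
import Data.Fin
open import Data.Fin using (Fin; toℕ; fromℕ<)
open import Data.Fin.Properties using (all?)
open import Data.Fin.Subset using (Subset; ∣_∣)
open import Data.Fin.Permutation using (Permutation; transpose; _⟨$⟩ˡ_)
import Data.Vec.Relation.Unary.All
open import Data.Vec using (Vec; []; _∷_; lookup; tabulate)
import Data.Vec.Properties as VecP
open import Data.List using (List; []; _∷_; map; concatMap; filter; length; allFin; upTo)
open import Data.Nat.ListAction using (sum; product)
open import Data.List.Relation.Unary.All using (All)
import Data.List.Relation.Unary.All as All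
import Data.Product
open import Data.Product using (_×_; _,_)
open import Relation.Nullary using (Dec; yes; no)
open import Relation.Nullary.Decidable using (_×-dec_; _→-dec_)
open import Relation.Unary using (Decidable)
open import Relation.Binary.PropositionalEquality using (_≡_)
open import Function.Bundles using (_⇔_)

count : ∀ {a p} {A : Set a} {P : A → Set p} → Decidable P → List A → ℕ
count P? xs = length (filter P? xs)

Σfin : (n : ℕ) → (Fin n → ℕ) → ℕ
Σfin n f = sum (map f (allFin n))

Πfin : (n : ℕ) → (Fin n → ℕ) → ℕ
Πfin n f = product (map f (allFin n))

-- Integer partitions in exponential notation.
-- A multiplicity vector c : Fin n → ℕ encodes (1^{c 0}, 2^{c 1}, …, n^{c (n-1)}),
-- i.e. c i is the number of parts equal to toℕ i + 1.

IsPartitionExp : (n : ℕ) → (Fin n → ℕ) → Set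
IsPartitionExp n c = Σfin n (λ i → suc (toℕ i) * c i) ≡ n

-- c_j for j ≥ 1 (zero if j = 0 or j > n)
mult : ∀ {n} → (Fin n → ℕ) → ℕ → ℕ
mult {n} c zero = 0
mult {n} c (suc j) with j <? n
... | yes j<n = c (fromℕ< j<n)
... | no _    = 0

allVecsUpTo : (B m : ℕ) → List (Vec ℕ m)
allVecsUpTo B zero    = [] ∷ []
allVecsUpTo B (suc m) = concatMap (λ x → map (x ∷_) (allVecsUpTo B m)) (upTo (suc B))

IsPartitionExpV : (k : ℕ) → Vec ℕ k → Set
IsPartitionExpV k b = IsPartitionExp k (lookup b)

isPartitionExpV? : (k : ℕ) → Decidable (IsPartitionExpV k)
isPartitionExpV? k b = Σfin k (λ i → suc (toℕ i) * lookup b i) ℕ.≟ k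

-- all partitions η of k, as multiplicity vectors (b_1,…,b_k)
-- (every multiplicity of a partition of k is ≤ k, so this lists each exactly once)
partitionsExp : (k : ℕ) → List (Vec ℕ k)
partitionsExp k = filter (isPartitionExpV? k) (allVecsUpTo k k)

partitionBinomSum : ∀ {n} → (Fin n → ℕ) → (k : ℕ) → ℕ
partitionBinomSum c k =
  sum (map (λ b → Πfin k (λ j → mult c (suc (toℕ j)) C lookup b j)) (partitionsExp k))

-- Simple graphs on vertex set Fin n (vertex i ↔ i+1), edges as a Bool matrix.

record Graph (n : ℕ) : Set where
  field
    adj   : Fin n → Fin n → Bool
    sym   : ∀ i j → adj i j ≡ adj j i
    irrefl : ∀ i → adj i i ≡ false
open Graph public

Edge : ∀ {n} → Graph n → Fin n → Fin n → Set
Edge G i j = T (adj G i j)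

data Reach {n} (G : Graph n) : Fin n → Fin n → Set where
  here : ∀ {u} → Reach G u u
  step : ∀ {u v w} → Edge G u v → Reach G v w → Reach G u w

blockSize : ∀ {n m} → (Fin n → Fin m) → Fin m → ℕ
blockSize {n} comp j = count (λ u → comp u Data.Fin.≟ j) (allFin n)

-- The connected components of G have sizes given by π = (1^{c_1},…,n^{c_n}):
-- there is a labelling of the vertices whose blocks are exactly the connected
-- components (u, v in the same block iff connected), and for each i = 1..n the
-- number of components of size i is c_i.
ComponentsHaveSizes : ∀ {n} → Graph n → (Fin n → ℕ) → Set
ComponentsHaveSizes {n} G c =
  Data.Product.∃ λ (m : ℕ) → Data.Product.∃ λ (comp : Fin n → Fin m) →
    (∀ u v → Reach G u v ⇔ (comp u ≡ comp v))
    × (∀ (j : Fin m) → Data.Product.∃ λ u → comp u ≡ j)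
    × (∀ (i : Fin n) → c i ≡ count (λ j → blockSize comp j ℕ.≟ suc (toℕ i)) (allFin m))

-- Action of a permutation on subsets: σ(α) = { σ x | x ∈ α },
-- i.e. y ∈ σ(α) iff σ⁻¹ y ∈ α.

_⋆_ : ∀ {n} → Permutation n n → Subset n → Subset n
σ ⋆ α = tabulate (λ y → lookup α (σ ⟨$⟩ˡ y))

FixedByEdges : ∀ {n} → Graph n → Subset n → Set
FixedByEdges {n} G α = ∀ (i j : Fin n) → Edge G i j → transpose i j ⋆ α ≡ α

fixedByEdges? : ∀ {n} (G : Graph n) → Decidable (FixedByEdges G)
fixedByEdges? G α =
  all? (λ i → all? (λ j → Data.Bool.T? (adj G i j) →-dec VecP.≡-dec BoolP._≟_ (transpose i j ⋆ α) α))

Good : ∀ {n} → Graph n → ℕ → Subset n → Set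
Good G k α = (∣ α ∣ ≡ k) × FixedByEdges G α

good? : ∀ {n} (G : Graph n) (k : ℕ) → Decidable (Good G k)
good? G k α = (∣ α ∣ ℕ.≟ k) ×-dec fixedByEdges? G α

allSubsets : (n : ℕ) → List (Subset n)
allSubsets zero    = [] ∷ []
allSubsets (suc n) = concatMap (λ b → map (b ∷_) (allSubsets n)) (true ∷ false ∷ [])

tuples : ∀ {a} {A : Set a} → List A → (ℓ : ℕ) → List (Vec A ℓ)
tuples xs zero    = [] ∷ []
tuples xs (suc ℓ) = concatMap (λ x → map (x ∷_) (tuples xs ℓ)) xs

f : ∀ {n} → Graph n → (k ℓ : ℕ) → ℕ
f {n} G k ℓ = count (λ (αs : Vec (Subset n) ℓ) → Data.Vec.Relation.Unary.All.all? (good? G k) αs)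
                    (tuples (allSubsets n) ℓ)

{-# OPTIONS --safe #-}
-- A subset fixed by the transposition (i j) contains both or neither of i and j, so the subsets fixed by
-- all edge transpositions are exactly the unions of connected components, and those of size k correspond
-- to sets of components of total size k. Adding the components one at a time multiplies the generating
-- function of such sets by 1 + z^size (Pascal's rule), so their number is the coefficient of z^k in
-- Π_j (1 + z^j)^{c_j}, which is Σ_η Π_j C(c_j, b_j). An ℓ-tuple is a free choice of ℓ such subsets.
module Submission where

open import Defs hiding (sym)

import Algebra.Properties.CommutativeSemigroup as CommSemigroupProperties
open import Data.Bool using (Bool; true; false; _∧_)
import Data.Bool.Properties as BoolP
open import Data.Fin using (Fin; zero; suc; toℕ; fromℕ<)
import Data.Fin.Properties as FP
open import Data.Fin.Permutation using (transpose)
import Data.Fin.Permutation.Components as PC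
open import Data.Fin.Subset using (Subset; ∣_∣)
open import Data.List using (List; []; _∷_; map; concatMap; filter; _++_; allFin; upTo)
open import Data.List.Membership.Propositional.Properties using (∈-filter⁺; ∈-length; ∈-allFin)
import Data.List.Properties as LP
open import Data.Nat
open import Data.Nat.Combinatorics using (_C_; nCk+nC[k+1]≡[n+1]C[k+1])
open import Data.Nat.ListAction using (sum; product)
open import Data.Nat.Properties
open import Data.Product using (_×_; _,_; proj₁; proj₂; ∃)
open import Data.Vec using (Vec; []; _∷_; lookup; tabulate)
import Data.Vec.Properties as VecP
import Data.Vec.Relation.Unary.All as VAll
open import Function.Base using (_∘_)
open import Function.Bundles using (_⇔_; mk⇔; Equivalence)
open import Relation.Binary.Definitions using (DecidableEquality)
open import Relation.Binary.PropositionalEquality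
open import Relation.Nullary using (Dec; yes; no; does; ¬_; contradiction)
open import Relation.Nullary.Decidable using (_×-dec_; dec-false; does-⇔)
open import Relation.Unary using (Decidable)

open ≡-Reasoning

private
  variable
    A B : Set

  module +-CS = CommSemigroupProperties +-commutativeSemigroup
  module *-CS = CommSemigroupProperties *-commutativeSemigroup

bit : Bool → ℕ
bit true  = 1
bit false = 0

bit-∧ : ∀ x y → bit (x ∧ y) ≡ bit x * bit y
bit-∧ true  y = sym (+-identityʳ (bit y))
bit-∧ false y = refl

𝟙 : {P : Set} → Dec P → ℕ
𝟙 P? = bit (does P?)

𝟙-⇔ : {P Q : Set} → P ⇔ Q → (P? : Dec P) (Q? : Dec Q) → 𝟙 P? ≡ 𝟙 Q?
𝟙-⇔ P⇔Q P? Q? = cong bit (does-⇔ P⇔Q P? Q?)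

𝟙-no : {P : Set} (P? : Dec P) → ¬ P → 𝟙 P? ≡ 0
𝟙-no P? ¬p = cong bit (dec-false P? ¬p)

𝟙-×-dec : {P Q : Set} (P? : Dec P) (Q? : Dec Q) → 𝟙 (P? ×-dec Q?) ≡ 𝟙 P? * 𝟙 Q?
𝟙-×-dec P? Q? = bit-∧ (does P?) (does Q?)

∑ : List A → (A → ℕ) → ℕ
∑ xs f = sum (map f xs)

infix 5 ∑
syntax ∑ xs (λ x → e) = ∑[ x ∈ xs ] e

module _ {f g : A → ℕ} where

  ∑-cong : ∀ xs → (∀ x → f x ≡ g x) → ∑ xs f ≡ ∑ xs g
  ∑-cong []       f≗g = refl
  ∑-cong (x ∷ xs) f≗g = cong₂ _+_ (f≗g x) (∑-cong xs f≗g)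

  ∑-+ : ∀ xs → ∑[ x ∈ xs ] (f x + g x) ≡ ∑ xs f + ∑ xs g
  ∑-+ []       = refl
  ∑-+ (x ∷ xs) = trans (cong (f x + g x +_) (∑-+ xs)) (+-CS.interchange (f x) (g x) _ _)

∑-0 : ∀ (xs : List A) {f : A → ℕ} → (∀ x → f x ≡ 0) → ∑ xs f ≡ 0
∑-0 []       f≗0 = refl
∑-0 (x ∷ xs) f≗0 = cong₂ _+_ (f≗0 x) (∑-0 xs f≗0)

∑-*ˡ : ∀ (xs : List A) c (f : A → ℕ) → ∑[ x ∈ xs ] (c * f x) ≡ c * ∑ xs f
∑-*ˡ []       c f = sym (*-zeroʳ c)
∑-*ˡ (x ∷ xs) c f = trans (cong (c * f x +_) (∑-*ˡ xs c f)) (sym (*-distribˡ-+ c (f x) _))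

∑-++ : ∀ (xs ys : List A) (f : A → ℕ) → ∑ (xs ++ ys) f ≡ ∑ xs f + ∑ ys f
∑-++ []       ys f = refl
∑-++ (x ∷ xs) ys f = trans (cong (f x +_) (∑-++ xs ys f)) (sym (+-assoc (f x) _ _))

∑-map : ∀ (xs : List A) (g : A → B) (f : B → ℕ) → ∑ (map g xs) f ≡ ∑ xs (f ∘ g)
∑-map []       g f = refl
∑-map (x ∷ xs) g f = cong (f (g x) +_) (∑-map xs g f)

∑-concatMap : ∀ (xs : List A) (g : A → List B) (f : B → ℕ) →
  ∑ (concatMap g xs) f ≡ ∑[ x ∈ xs ] ∑ (g x) f
∑-concatMap []       g f = refl
∑-concatMap (x ∷ xs) g f =
  trans (∑-++ (g x) (concatMap g xs) f) (cong (∑ (g x) f +_) (∑-concatMap xs g f))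

∑-comm : ∀ (xs : List A) (ys : List B) (F : A → B → ℕ) →
  ∑[ x ∈ xs ] ∑[ y ∈ ys ] F x y ≡ ∑[ y ∈ ys ] ∑[ x ∈ xs ] F x y
∑-comm []       ys F = sym (∑-0 ys (λ _ → refl))
∑-comm (x ∷ xs) ys F = trans (cong (∑ ys (F x) +_) (∑-comm xs ys F)) (sym (∑-+ ys))

∑-filter : ∀ {P : A → Set} (P? : Decidable P) (xs : List A) (f : A → ℕ) →
  ∑ (filter P? xs) f ≡ ∑[ x ∈ xs ] 𝟙 (P? x) * f x
∑-filter P? []       f = refl
∑-filter P? (x ∷ xs) f with does (P? x)
... | true  = cong₂ _+_ (sym (+-identityʳ (f x))) (∑-filter P? xs f)
... | false = ∑-filter P? xs f

count≡∑𝟙 : ∀ {P : A → Set} (P? : Decidable P) (xs : List A) → count P? xs ≡ ∑[ x ∈ xs ] 𝟙 (P? x)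
count≡∑𝟙 P? []       = refl
count≡∑𝟙 P? (x ∷ xs) with does (P? x)
... | true  = cong suc (count≡∑𝟙 P? xs)
... | false = count≡∑𝟙 P? xs

∑-*ʳ : ∀ (xs : List A) c (f : A → ℕ) → ∑[ x ∈ xs ] f x * c ≡ ∑ xs f * c
∑-*ʳ xs c f = begin
  ∑[ x ∈ xs ] f x * c   ≡⟨ ∑-cong xs (λ x → *-comm (f x) c) ⟩
  ∑[ x ∈ xs ] c * f x   ≡⟨ ∑-*ˡ xs c f ⟩
  c * ∑ xs f            ≡⟨ *-comm c _ ⟩
  ∑ xs f * c            ∎

∑-upTo-suc : ∀ N (g : ℕ → ℕ) → ∑ (upTo (suc N)) g ≡ g 0 + ∑ (upTo N) (g ∘ suc)
∑-upTo-suc N g =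
  cong (λ xs → g 0 + sum xs) (trans (LP.map-applyUpTo suc g N) (sym (LP.map-upTo (g ∘ suc) N)))

∑-upTo-snoc : ∀ N (g : ℕ → ℕ) → ∑ (upTo (suc N)) g ≡ ∑ (upTo N) g + g N
∑-upTo-snoc N g = begin
  ∑ (upTo (suc N)) g         ≡⟨ cong (λ xs → ∑ xs g) (LP.upTo-∷ʳ N) ⟨
  ∑ (upTo N ++ N ∷ []) g     ≡⟨ ∑-++ (upTo N) (N ∷ []) g ⟩
  ∑ (upTo N) g + (g N + 0)   ≡⟨ cong (∑ (upTo N) g +_) (+-identityʳ (g N)) ⟩
  ∑ (upTo N) g + g N         ∎

∑-∷-product : ∀ {m} (xs : List A) (ys : List (Vec A m)) (F : Vec A (suc m) → ℕ) →
  ∑ (concatMap (λ x → map (x ∷_) ys) xs) F ≡ ∑[ x ∈ xs ] ∑[ v ∈ ys ] F (x ∷ v)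
∑-∷-product xs ys F =
  trans (∑-concatMap xs (λ x → map (x ∷_) ys) F) (∑-cong xs (λ x → ∑-map ys (x ∷_) F))

map-allFin-suc : ∀ n (f : Fin (suc n) → A) → map f (allFin (suc n)) ≡ f zero ∷ map (f ∘ suc) (allFin n)
map-allFin-suc n f = cong (f zero ∷_) (trans (LP.map-tabulate suc f) (sym (LP.map-tabulate (λ i → i) (f ∘ suc))))

∑-allFin-suc : ∀ n (f : Fin (suc n) → ℕ) → ∑ (allFin (suc n)) f ≡ f zero + ∑ (allFin n) (f ∘ suc)
∑-allFin-suc n f = cong sum (map-allFin-suc n f)

Πfin-suc : ∀ n (f : Fin (suc n) → ℕ) → Πfin (suc n) f ≡ f zero * Πfin n (f ∘ suc)
Πfin-suc n f = cong product (map-allFin-suc n f)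

-- xs lists every element of A exactly once.
record Enumerates (_≟_ : DecidableEquality A) (xs : List A) : Set where
  field
    sift : ∀ y (h : A → ℕ) → ∑[ x ∈ xs ] 𝟙 (x ≟ y) * h x ≡ h y
open Enumerates

allFin-enumerates : ∀ n → Enumerates FP._≟_ (allFin n)
allFin-enumerates (suc n) .sift zero h = begin
  ∑[ x ∈ allFin (suc n) ] 𝟙 (x FP.≟ zero) * h x
    ≡⟨ ∑-allFin-suc n _ ⟩
  h zero + 0 + (∑[ x ∈ allFin n ] 0)
    ≡⟨ cong₂ _+_ (+-identityʳ (h zero)) (∑-0 (allFin n) (λ _ → refl)) ⟩
  h zero + 0
    ≡⟨ +-identityʳ (h zero) ⟩
  h zero ∎
allFin-enumerates (suc n) .sift (suc y) h =
  trans (∑-allFin-suc n (λ x → 𝟙 (x FP.≟ suc y) * h x)) (allFin-enumerates n .sift y (h ∘ suc))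

bool-enumerates : Enumerates BoolP._≟_ (true ∷ false ∷ [])
bool-enumerates .sift true  h = trans (+-identityʳ _) (+-identityʳ (h true))
bool-enumerates .sift false h = trans (+-identityʳ _) (+-identityʳ (h false))

∷-enumerates : ∀ {m} {_≟_ : DecidableEquality A} {xs : List A} {ys : List (Vec A m)} →
  Enumerates _≟_ xs → Enumerates (VecP.≡-dec _≟_) ys →
  Enumerates (VecP.≡-dec _≟_) (concatMap (λ x → map (x ∷_) ys) xs)
∷-enumerates {A = A} {_≟_ = _≟_} {xs} {ys} enum-xs enum-ys .sift (a ∷ as) h = begin
  ∑[ v ∈ concatMap (λ x → map (x ∷_) ys) xs ] 𝟙 (v ≟ᵥ (a ∷ as)) * h v
    ≡⟨ ∑-∷-product xs ys _ ⟩
  ∑[ x ∈ xs ] ∑[ v ∈ ys ] 𝟙 ((x ∷ v) ≟ᵥ (a ∷ as)) * h (x ∷ v)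
    ≡⟨ ∑-cong xs (λ x → ∑-cong ys (λ v →
         trans (cong (_* h (x ∷ v)) (𝟙-×-dec (x ≟ a) (v ≟ᵥ as)))
               (*-assoc (𝟙 (x ≟ a)) (𝟙 (v ≟ᵥ as)) (h (x ∷ v))))) ⟩
  ∑[ x ∈ xs ] ∑[ v ∈ ys ] 𝟙 (x ≟ a) * (𝟙 (v ≟ᵥ as) * h (x ∷ v))
    ≡⟨ ∑-cong xs (λ x → ∑-*ˡ ys (𝟙 (x ≟ a)) _) ⟩
  ∑[ x ∈ xs ] 𝟙 (x ≟ a) * (∑[ v ∈ ys ] 𝟙 (v ≟ᵥ as) * h (x ∷ v))
    ≡⟨ ∑-cong xs (λ x → cong (𝟙 (x ≟ a) *_) (enum-ys .sift as (λ v → h (x ∷ v)))) ⟩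
  ∑[ x ∈ xs ] 𝟙 (x ≟ a) * h (x ∷ as)
    ≡⟨ enum-xs .sift a (λ x → h (x ∷ as)) ⟩
  h (a ∷ as) ∎
  where
  _≟ᵥ_ : ∀ {m} → DecidableEquality (Vec A m)
  _≟ᵥ_ = VecP.≡-dec _≟_

allSubsets-enumerates : ∀ n → Enumerates (VecP.≡-dec BoolP._≟_) (allSubsets n)
allSubsets-enumerates zero .sift [] h = trans (+-identityʳ _) (+-identityʳ (h []))
allSubsets-enumerates (suc n) = ∷-enumerates bool-enumerates (allSubsets-enumerates n)

count-tuples : ∀ {P : A → Set} (P? : Decidable P) (xs : List A) ℓ →
  count (VAll.all? P?) (tuples xs ℓ) ≡ count P? xs ^ ℓ
count-tuples P? xs zero    = refl
count-tuples P? xs (suc ℓ) = begin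
  count (VAll.all? P?) (tuples xs (suc ℓ))
    ≡⟨ count≡∑𝟙 (VAll.all? P?) (tuples xs (suc ℓ)) ⟩
  ∑[ v ∈ tuples xs (suc ℓ) ] 𝟙 (VAll.all? P? v)
    ≡⟨ ∑-∷-product xs (tuples xs ℓ) _ ⟩
  ∑[ x ∈ xs ] ∑[ v ∈ tuples xs ℓ ] 𝟙 (VAll.all? P? (x ∷ v))
    ≡⟨ ∑-cong xs (λ x → trans (∑-cong (tuples xs ℓ) (λ v → 𝟙-×-dec (P? x) (VAll.all? P? v)))
                              (∑-*ˡ (tuples xs ℓ) (𝟙 (P? x)) _)) ⟩
  ∑[ x ∈ xs ] 𝟙 (P? x) * (∑[ v ∈ tuples xs ℓ ] 𝟙 (VAll.all? P? v))
    ≡⟨ ∑-*ʳ xs _ (λ x → 𝟙 (P? x)) ⟩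
  (∑[ x ∈ xs ] 𝟙 (P? x)) * (∑[ v ∈ tuples xs ℓ ] 𝟙 (VAll.all? P? v))
    ≡⟨ sym (cong₂ _*_ (count≡∑𝟙 P? xs) (count≡∑𝟙 (VAll.all? P?) (tuples xs ℓ))) ⟩
  count P? xs * count (VAll.all? P?) (tuples xs ℓ)
    ≡⟨ cong (count P? xs *_) (count-tuples P? xs ℓ) ⟩
  count P? xs ^ suc ℓ ∎

count-bijection : ∀ {_≟ᴬ_ : DecidableEquality A} {_≟ᴮ_ : DecidableEquality B} {xs ys} →
  Enumerates _≟ᴬ_ xs → Enumerates _≟ᴮ_ ys →
  ∀ {P : A → Set} {Q : B → Set} (P? : Decidable P) (Q? : Decidable Q) (φ : B → A) (ψ : A → B) →
  (∀ y → ψ (φ y) ≡ y) → (∀ x → P x → φ (ψ x) ≡ x) → (∀ y → P (φ y) ⇔ Q y) →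
  count P? xs ≡ count Q? ys
count-bijection {_≟ᴬ_ = _≟ᴬ_} {_≟ᴮ_} {xs} {ys} enum-xs enum-ys {P} {Q} P? Q? φ ψ ψ∘φ φ∘ψ P∘φ⇔Q =
  begin
  count P? xs
    ≡⟨ count≡∑𝟙 P? xs ⟩
  ∑[ x ∈ xs ] 𝟙 (P? x)
    ≡⟨ ∑-cong xs (λ x → sym (enum-ys .sift (ψ x) (λ _ → 𝟙 (P? x)))) ⟩
  ∑[ x ∈ xs ] ∑[ y ∈ ys ] 𝟙 (y ≟ᴮ ψ x) * 𝟙 (P? x)
    ≡⟨ ∑-cong xs (λ x → ∑-cong ys (λ y → matched x y)) ⟩
  ∑[ x ∈ xs ] ∑[ y ∈ ys ] 𝟙 (x ≟ᴬ φ y) * 𝟙 (Q? y)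
    ≡⟨ ∑-comm xs ys _ ⟩
  ∑[ y ∈ ys ] ∑[ x ∈ xs ] 𝟙 (x ≟ᴬ φ y) * 𝟙 (Q? y)
    ≡⟨ ∑-cong ys (λ y → enum-xs .sift (φ y) (λ _ → 𝟙 (Q? y))) ⟩
  ∑[ y ∈ ys ] 𝟙 (Q? y)
    ≡⟨ count≡∑𝟙 Q? ys ⟨
  count Q? ys ∎
  where
  matched : ∀ x y → 𝟙 (y ≟ᴮ ψ x) * 𝟙 (P? x) ≡ 𝟙 (x ≟ᴬ φ y) * 𝟙 (Q? y)
  matched x y = begin
    𝟙 (y ≟ᴮ ψ x) * 𝟙 (P? x)    ≡⟨ 𝟙-×-dec (y ≟ᴮ ψ x) (P? x) ⟨
    𝟙 ((y ≟ᴮ ψ x) ×-dec P? x)  ≡⟨ 𝟙-⇔ (mk⇔ to from) ((y ≟ᴮ ψ x) ×-dec P? x) ((x ≟ᴬ φ y) ×-dec Q? y) ⟩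
    𝟙 ((x ≟ᴬ φ y) ×-dec Q? y)  ≡⟨ 𝟙-×-dec (x ≟ᴬ φ y) (Q? y) ⟩
    𝟙 (x ≟ᴬ φ y) * 𝟙 (Q? y)    ∎
    where
    to : y ≡ ψ x × P x → x ≡ φ y × Q y
    to (refl , Px) = sym (φ∘ψ x Px) , Equivalence.to (P∘φ⇔Q (ψ x)) (subst P (sym (φ∘ψ x Px)) Px)
    from : x ≡ φ y × Q y → y ≡ ψ x × P x
    from (refl , Qy) = sym (ψ∘φ y) , Equivalence.from (P∘φ⇔Q y) Qy

Series : Set
Series = ℕ → ℕ

infixr 5 z^_·_

z^_·_ : ℕ → Series → Series
(z^ a · g) t with a ≤? t
... | yes _ = g (t ∸ a)
... | no  _ = 0

module _ (a : ℕ) where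

  z^-≤ : ∀ g t → a ≤ t → (z^ a · g) t ≡ g (t ∸ a)
  z^-≤ g t a≤t with a ≤? t
  ... | yes _   = refl
  ... | no  a≰t = contradiction a≤t a≰t

  z^-> : ∀ g t → t < a → (z^ a · g) t ≡ 0
  z^-> g t t<a with a ≤? t
  ... | yes a≤t = contradiction a≤t (<⇒≱ t<a)
  ... | no  _   = refl

  z^-cong : ∀ {g h} t → (∀ t′ → t′ ≤ t → g t′ ≡ h t′) → (z^ a · g) t ≡ (z^ a · h) t
  z^-cong t g≗h with a ≤? t
  ... | yes _ = g≗h (t ∸ a) (m∸n≤m t a)
  ... | no  _ = refl

  z^-+ : ∀ g h t → (z^ a · λ t′ → g t′ + h t′) t ≡ (z^ a · g) t + (z^ a · h) t
  z^-+ g h t with a ≤? t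
  ... | yes _ = refl
  ... | no  _ = refl

  z^-*ˡ : ∀ c g t → (z^ a · λ t′ → c * g t′) t ≡ c * (z^ a · g) t
  z^-*ˡ c g t with a ≤? t
  ... | yes _ = refl
  ... | no  _ = sym (*-zeroʳ c)

  z^-*ʳ : ∀ c g t → (z^ a · λ t′ → g t′ * c) t ≡ (z^ a · g) t * c
  z^-*ʳ c g t with a ≤? t
  ... | yes _ = refl
  ... | no  _ = refl

  z^-∑ : ∀ (xs : List A) (F : A → Series) t →
    (z^ a · λ t′ → ∑[ x ∈ xs ] F x t′) t ≡ ∑[ x ∈ xs ] (z^ a · F x) t
  z^-∑ xs F t with a ≤? t
  ... | yes _ = refl
  ... | no  _ = sym (∑-0 xs (λ _ → refl))

z^0 : ∀ g t → (z^ 0 · g) t ≡ g t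
z^0 g t = z^-≤ 0 g t z≤n

z^-z^ : ∀ a b g t → (z^ a · z^ b · g) t ≡ (z^ (a + b) · g) t
z^-z^ a b g t with a ≤? t
... | no a≰t = sym (z^-> (a + b) g t (≰⇒> (a≰t ∘ m+n≤o⇒m≤o a)))
... | yes a≤t with b ≤? t ∸ a
...   | yes b≤t∸a = trans (cong g (∸-+-assoc t a b))
                          (sym (z^-≤ (a + b) g t (subst (a + b ≤_) (m+[n∸m]≡n a≤t) (+-monoʳ-≤ a b≤t∸a))))
...   | no  b≰t∸a = sym (z^-> (a + b) g t (≰⇒> (λ a+b≤t →
                      b≰t∸a (m+n≤o⇒m≤o∸n b (subst (_≤ t) (+-comm a b) a+b≤t)))))

z^-comm : ∀ a b g t → (z^ a · z^ b · g) t ≡ (z^ b · z^ a · g) t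
z^-comm a b g t = begin
  (z^ a · z^ b · g) t   ≡⟨ z^-z^ a b g t ⟩
  (z^ (a + b) · g) t    ≡⟨ cong (λ c → (z^ c · g) t) (+-comm a b) ⟩
  (z^ (b + a) · g) t    ≡⟨ z^-z^ b a g t ⟨
  (z^ b · z^ a · g) t   ∎

𝟙-z^ : ∀ a w t → 𝟙 (a + w ≟ t) ≡ (z^ a · λ t′ → 𝟙 (w ≟ t′)) t
𝟙-z^ a w t with a ≤? t
... | yes a≤t = 𝟙-⇔ (mk⇔ (λ a+w≡t → trans (sym (m+n∸m≡n a w)) (cong (_∸ a) a+w≡t))
                         (λ w≡t∸a → trans (cong (a +_) w≡t∸a) (m+[n∸m]≡n a≤t)))
                    (a + w ≟ t) (w ≟ t ∸ a)
... | no  a≰t = 𝟙-no (a + w ≟ t) (λ a+w≡t → a≰t (subst (a ≤_) a+w≡t (m≤m+n a w)))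

subsetWeight : ∀ {m} → (Fin m → ℕ) → Subset m → ℕ
subsetWeight {m} w X = ∑[ j ∈ allFin m ] bit (lookup X j) * w j

subsetsOfWeight : ∀ m → (Fin m → ℕ) → Series
subsetsOfWeight m w t = count (λ X → subsetWeight w X ≟ t) (allSubsets m)

occurrences : ∀ {m} → (Fin m → ℕ) → ℕ → ℕ
occurrences {m} w v = count (λ j → w j ≟ v) (allFin m)

occurrences-suc : ∀ {m} (w : Fin (suc m) → ℕ) v → occurrences w v ≡ 𝟙 (w zero ≟ v) + occurrences (w ∘ suc) v
occurrences-suc {m} w v = begin
  occurrences w v
    ≡⟨ count≡∑𝟙 (λ j → w j ≟ v) (allFin (suc m)) ⟩
  ∑[ j ∈ allFin (suc m) ] 𝟙 (w j ≟ v)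
    ≡⟨ ∑-allFin-suc m (λ j → 𝟙 (w j ≟ v)) ⟩
  𝟙 (w zero ≟ v) + (∑[ j ∈ allFin m ] 𝟙 (w (suc j) ≟ v))
    ≡⟨ cong (𝟙 (w zero ≟ v) +_) (count≡∑𝟙 (λ j → w (suc j) ≟ v) (allFin m)) ⟨
  𝟙 (w zero ≟ v) + occurrences (w ∘ suc) v ∎

subsetsOfWeight-suc : ∀ m (w : Fin (suc m) → ℕ) t →
  subsetsOfWeight (suc m) w t ≡ (z^ w zero · subsetsOfWeight m (w ∘ suc)) t + subsetsOfWeight m (w ∘ suc) t
subsetsOfWeight-suc m w t = begin
  subsetsOfWeight (suc m) w t
    ≡⟨ count≡∑𝟙 (λ X → subsetWeight w X ≟ t) (allSubsets (suc m)) ⟩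
  ∑[ X ∈ allSubsets (suc m) ] 𝟙 (subsetWeight w X ≟ t)
    ≡⟨ ∑-∷-product (true ∷ false ∷ []) (allSubsets m) _ ⟩
  (∑[ X ∈ allSubsets m ] 𝟙 (subsetWeight w (true ∷ X) ≟ t))
    + ((∑[ X ∈ allSubsets m ] 𝟙 (subsetWeight w (false ∷ X) ≟ t)) + 0)
    ≡⟨ cong₂ _+_ (∑-cong (allSubsets m) with-first)
                 (trans (+-identityʳ _) (∑-cong (allSubsets m) without-first)) ⟩
  (∑[ X ∈ allSubsets m ] (z^ w zero · I X) t) + (∑[ X ∈ allSubsets m ] I X t)
    ≡⟨ cong (_+ (∑[ X ∈ allSubsets m ] I X t)) (z^-∑ (w zero) (allSubsets m) I t) ⟨
  (z^ w zero · λ t′ → ∑[ X ∈ allSubsets m ] I X t′) t + (∑[ X ∈ allSubsets m ] I X t)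
    ≡⟨ cong₂ _+_ (z^-cong (w zero) t (λ t′ _ → sym (N≡∑ t′))) (sym (N≡∑ t)) ⟩
  (z^ w zero · subsetsOfWeight m (w ∘ suc)) t + subsetsOfWeight m (w ∘ suc) t ∎
  where
  I : Subset m → Series
  I X t′ = 𝟙 (subsetWeight (w ∘ suc) X ≟ t′)
  N≡∑ : ∀ t′ → subsetsOfWeight m (w ∘ suc) t′ ≡ ∑[ X ∈ allSubsets m ] I X t′
  N≡∑ t′ = count≡∑𝟙 (λ X → subsetWeight (w ∘ suc) X ≟ t′) (allSubsets m)
  weight-∷ : ∀ b X → subsetWeight w (b ∷ X) ≡ bit b * w zero + subsetWeight (w ∘ suc) X
  weight-∷ b X = ∑-allFin-suc m (λ j → bit (lookup (b ∷ X) j) * w j)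
  with-first : ∀ X → 𝟙 (subsetWeight w (true ∷ X) ≟ t) ≡ (z^ w zero · I X) t
  with-first X = begin
    𝟙 (subsetWeight w (true ∷ X) ≟ t)
      ≡⟨ cong (λ p → 𝟙 (p ≟ t)) (weight-∷ true X) ⟩
    𝟙 (1 * w zero + subsetWeight (w ∘ suc) X ≟ t)
      ≡⟨ cong (λ p → 𝟙 (p + subsetWeight (w ∘ suc) X ≟ t)) (*-identityˡ (w zero)) ⟩
    𝟙 (w zero + subsetWeight (w ∘ suc) X ≟ t)
      ≡⟨ 𝟙-z^ (w zero) (subsetWeight (w ∘ suc) X) t ⟩
    (z^ w zero · I X) t ∎
  without-first : ∀ X → 𝟙 (subsetWeight w (false ∷ X) ≟ t) ≡ I X t
  without-first X = cong (λ p → 𝟙 (p ≟ t)) (weight-∷ false X)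

sizeOf : ∀ {m} → (ℕ → ℕ) → Vec ℕ m → ℕ
sizeOf {m} s b = Σfin m (λ i → s (toℕ i) * lookup b i)

ways : ∀ {m} → (ℕ → ℕ) → Vec ℕ m → ℕ
ways {m} a b = Πfin m (λ i → a (toℕ i) C lookup b i)

sizeOf-∷ : ∀ {m} s x (v : Vec ℕ m) → sizeOf s (x ∷ v) ≡ s 0 * x + sizeOf (s ∘ suc) v
sizeOf-∷ {m} s x v = ∑-allFin-suc m (λ i → s (toℕ i) * lookup (x ∷ v) i)

ways-∷ : ∀ {m} a x (v : Vec ℕ m) → ways a (x ∷ v) ≡ (a 0 C x) * ways (a ∘ suc) v
ways-∷ {m} a x v = Πfin-suc m (λ i → a (toℕ i) C lookup (x ∷ v) i)

module Truncated (D : ℕ) where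

  infixr 5 [1+z^_]^_·_

  -- Σ_{x ≤ D} (c C x) z^{e x}: equals (1 + z^e)^c in all degrees ≤ D as soon as 1 ≤ e.
  [1+z^_]^_·_ : ℕ → ℕ → Series → Series
  ([1+z^ e ]^ c · T) t = ∑[ x ∈ upTo (suc D) ] (c C x) * (z^ e * x · T) t

  [1+z^]^0 : ∀ e T t → ([1+z^ e ]^ 0 · T) t ≡ T t
  [1+z^]^0 e T t = begin
    ([1+z^ e ]^ 0 · T) t                         ≡⟨ ∑-upTo-suc D (λ x → (0 C x) * (z^ e * x · T) t) ⟩
    1 * (z^ e * 0 · T) t + (∑[ x ∈ upTo D ] 0)   ≡⟨ cong (1 * (z^ e * 0 · T) t +_) (∑-0 (upTo D) (λ _ → refl)) ⟩
    1 * (z^ e * 0 · T) t + 0                     ≡⟨ cong (_+ 0) (*-identityˡ ((z^ e * 0 · T) t)) ⟩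
    (z^ e * 0 · T) t + 0                         ≡⟨ +-identityʳ _ ⟩
    (z^ e * 0 · T) t                             ≡⟨ cong (λ a → (z^ a · T) t) (*-zeroʳ e) ⟩
    (z^ 0 · T) t                                 ≡⟨ z^0 T t ⟩
    T t                                          ∎

  [1+z^]-cong : ∀ e c {T U} t → (∀ t′ → t′ ≤ t → T t′ ≡ U t′) →
    ([1+z^ e ]^ c · T) t ≡ ([1+z^ e ]^ c · U) t
  [1+z^]-cong e c t T≗U = ∑-cong (upTo (suc D)) (λ x → cong ((c C x) *_) (z^-cong (e * x) t T≗U))

  [1+z^]-+ : ∀ e c T U t →
    ([1+z^ e ]^ c · λ t′ → T t′ + U t′) t ≡ ([1+z^ e ]^ c · T) t + ([1+z^ e ]^ c · U) t
  [1+z^]-+ e c T U t = trans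
    (∑-cong (upTo (suc D)) (λ x →
      trans (cong ((c C x) *_) (z^-+ (e * x) T U t)) (*-distribˡ-+ (c C x) _ _)))
    (∑-+ {f = λ x → (c C x) * (z^ e * x · T) t} {g = λ x → (c C x) * (z^ e * x · U) t} (upTo (suc D)))

  [1+z^]-z^ : ∀ e c w T t → ([1+z^ e ]^ c · z^ w · T) t ≡ (z^ w · [1+z^ e ]^ c · T) t
  [1+z^]-z^ e c w T t = begin
    ∑[ x ∈ upTo (suc D) ] (c C x) * (z^ e * x · z^ w · T) t
      ≡⟨ ∑-cong (upTo (suc D)) (λ x → cong ((c C x) *_) (z^-comm (e * x) w T t)) ⟩
    ∑[ x ∈ upTo (suc D) ] (c C x) * (z^ w · z^ e * x · T) t
      ≡⟨ ∑-cong (upTo (suc D)) (λ x → z^-*ˡ w (c C x) (z^ e * x · T) t) ⟨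
    ∑[ x ∈ upTo (suc D) ] (z^ w · λ t′ → (c C x) * (z^ e * x · T) t′) t
      ≡⟨ z^-∑ w (upTo (suc D)) (λ x t′ → (c C x) * (z^ e * x · T) t′) t ⟨
    (z^ w · [1+z^ e ]^ c · T) t ∎

  [1+z^]-pascal : ∀ e c T t → 1 ≤ e → t ≤ D →
    ([1+z^ e ]^ suc c · T) t ≡ ([1+z^ e ]^ c · T) t + ([1+z^ e ]^ c · z^ e · T) t
  [1+z^]-pascal e c T t 1≤e t≤D = begin
    ([1+z^ e ]^ suc c · T) t
      ≡⟨ ∑-upTo-suc D (λ x → (suc c C x) * h x) ⟩
    1 * h 0 + (∑[ x ∈ upTo D ] (suc c C suc x) * h (suc x))
      ≡⟨ cong (1 * h 0 +_) (∑-cong (upTo D) (λ x →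
           trans (cong (_* h (suc x)) (sym (nCk+nC[k+1]≡[n+1]C[k+1] c x))) (*-distribʳ-+ (h (suc x)) (c C x) _))) ⟩
    1 * h 0 + (∑[ x ∈ upTo D ] ((c C x) * h (suc x) + (c C suc x) * h (suc x)))
      ≡⟨ cong (1 * h 0 +_) (∑-+ (upTo D)) ⟩
    1 * h 0 + (lower + upper)
      ≡⟨ cong (1 * h 0 +_) (+-comm lower upper) ⟩
    1 * h 0 + (upper + lower)
      ≡⟨ +-assoc (1 * h 0) upper lower ⟨
    1 * h 0 + upper + lower
      ≡⟨ cong₂ _+_ (sym (∑-upTo-suc D (λ x → (c C x) * h x))) (sym shifted) ⟩
    ([1+z^ e ]^ c · T) t + ([1+z^ e ]^ c · z^ e · T) t ∎
    where
    h : ℕ → ℕ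
    h x = (z^ e * x · T) t
    lower upper : ℕ
    lower = ∑[ x ∈ upTo D ] (c C x) * h (suc x)
    upper = ∑[ x ∈ upTo D ] (c C suc x) * h (suc x)
    top-vanishes : h (suc D) ≡ 0
    top-vanishes = z^-> (e * suc D) T t (≤-trans (s≤s t≤D) (m≤n*m (suc D) e ⦃ >-nonZero 1≤e ⦄))
    shifted : ([1+z^ e ]^ c · z^ e · T) t ≡ lower
    shifted = begin
      ∑[ x ∈ upTo (suc D) ] (c C x) * (z^ e * x · z^ e · T) t
        ≡⟨ ∑-cong (upTo (suc D)) (λ x → cong ((c C x) *_) (begin
             (z^ e * x · z^ e · T) t   ≡⟨ z^-comm (e * x) e T t ⟩
             (z^ e · z^ e * x · T) t   ≡⟨ z^-z^ e (e * x) T t ⟩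
             (z^ e + e * x · T) t      ≡⟨ cong (λ a → (z^ a · T) t) (*-suc e x) ⟨
             h (suc x)                 ∎)) ⟩
      ∑[ x ∈ upTo (suc D) ] (c C x) * h (suc x)
        ≡⟨ ∑-upTo-snoc D _ ⟩
      lower + (c C D) * h (suc D)
        ≡⟨ cong (λ y → lower + (c C D) * y) top-vanishes ⟩
      lower + (c C D) * 0
        ≡⟨ cong (lower +_) (*-zeroʳ (c C D)) ⟩
      lower + 0
        ≡⟨ +-identityʳ lower ⟩
      lower ∎

  -- Coefficient of z^t in Π_{i<m} (1 + z^{s i})^{a i}: the number of ways to pick, for each i < m,
  -- b i ≤ D of a i objects of size s i, of total size t.
  selections : (s a : ℕ → ℕ) (m : ℕ) → Series
  selections s a m t = ∑[ b ∈ allVecsUpTo D m ] 𝟙 (sizeOf s b ≟ t) * ways a b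

  selections-0 : ∀ s a t → selections s a 0 t ≡ 𝟙 (0 ≟ t)
  selections-0 s a t = trans (+-identityʳ _) (*-identityʳ (𝟙 (0 ≟ t)))

  selections-suc : ∀ s a m t →
    selections s a (suc m) t ≡ ([1+z^ s 0 ]^ a 0 · selections (s ∘ suc) (a ∘ suc) m) t
  selections-suc s a m t = begin
    selections s a (suc m) t
      ≡⟨ ∑-∷-product (upTo (suc D)) (allVecsUpTo D m) _ ⟩
    ∑[ x ∈ upTo (suc D) ] ∑[ v ∈ allVecsUpTo D m ] 𝟙 (sizeOf s (x ∷ v) ≟ t) * ways a (x ∷ v)
      ≡⟨ ∑-cong (upTo (suc D)) (λ x → ∑-cong (allVecsUpTo D m) (term x)) ⟩
    ∑[ x ∈ upTo (suc D) ] ∑[ v ∈ allVecsUpTo D m ] (a 0 C x) * (z^ s 0 * x · G v) t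
      ≡⟨ ∑-cong (upTo (suc D)) (λ x → ∑-*ˡ (allVecsUpTo D m) (a 0 C x) _) ⟩
    ∑[ x ∈ upTo (suc D) ] (a 0 C x) * (∑[ v ∈ allVecsUpTo D m ] (z^ s 0 * x · G v) t)
      ≡⟨ ∑-cong (upTo (suc D)) (λ x → cong ((a 0 C x) *_) (z^-∑ (s 0 * x) (allVecsUpTo D m) G t)) ⟨
    ([1+z^ s 0 ]^ a 0 · selections (s ∘ suc) (a ∘ suc) m) t ∎
    where
    I : Vec ℕ m → Series
    I v t′ = 𝟙 (sizeOf (s ∘ suc) v ≟ t′)
    G : Vec ℕ m → Series
    G v t′ = I v t′ * ways (a ∘ suc) v
    term : ∀ x v → 𝟙 (sizeOf s (x ∷ v) ≟ t) * ways a (x ∷ v) ≡ (a 0 C x) * (z^ s 0 * x · G v) t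
    term x v = begin
      𝟙 (sizeOf s (x ∷ v) ≟ t) * ways a (x ∷ v)
        ≡⟨ cong₂ (λ p q → 𝟙 (p ≟ t) * q) (sizeOf-∷ s x v) (ways-∷ a x v) ⟩
      𝟙 (s 0 * x + sizeOf (s ∘ suc) v ≟ t) * ((a 0 C x) * ways (a ∘ suc) v)
        ≡⟨ cong (_* _) (𝟙-z^ (s 0 * x) (sizeOf (s ∘ suc) v) t) ⟩
      (z^ s 0 * x · I v) t * ((a 0 C x) * ways (a ∘ suc) v)
        ≡⟨ *-CS.x∙yz≈y∙xz ((z^ s 0 * x · I v) t) (a 0 C x) (ways (a ∘ suc) v) ⟩
      (a 0 C x) * ((z^ s 0 * x · I v) t * ways (a ∘ suc) v)
        ≡⟨ cong ((a 0 C x) *_) (z^-*ʳ (s 0 * x) (ways (a ∘ suc) v) (I v) t) ⟨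
      (a 0 C x) * (z^ s 0 * x · G v) t ∎

  selections-cong : ∀ s {a a′} m t → (∀ i → i < m → a i ≡ a′ i) →
    selections s a m t ≡ selections s a′ m t
  selections-cong s m t a≗a′ = ∑-cong (allVecsUpTo D m) (λ b →
    cong (λ xs → 𝟙 (sizeOf s b ≟ t) * product xs)
         (LP.map-cong (λ i → cong (_C lookup b i) (a≗a′ (toℕ i) (FP.toℕ<n i))) (allFin m)))

  selections-empty : ∀ s a m t → (∀ i → a i ≡ 0) → selections s a m t ≡ 𝟙 (0 ≟ t)
  selections-empty s a zero    t _   = selections-0 s a t
  selections-empty s a (suc m) t a≗0 = begin
    selections s a (suc m) t
      ≡⟨ selections-suc s a m t ⟩
    ([1+z^ s 0 ]^ a 0 · selections (s ∘ suc) (a ∘ suc) m) t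
      ≡⟨ cong (λ c → ([1+z^ s 0 ]^ c · selections (s ∘ suc) (a ∘ suc) m) t) (a≗0 0) ⟩
    ([1+z^ s 0 ]^ 0 · selections (s ∘ suc) (a ∘ suc) m) t
      ≡⟨ [1+z^]^0 (s 0) _ t ⟩
    selections (s ∘ suc) (a ∘ suc) m t
      ≡⟨ selections-empty (s ∘ suc) (a ∘ suc) m t (a≗0 ∘ suc) ⟩
    𝟙 (0 ≟ t) ∎

  selections-suc-+-z^ : ∀ s a m w t →
    ([1+z^ s 0 ]^ a 0 · selections (s ∘ suc) (a ∘ suc) m) t
      + ([1+z^ s 0 ]^ a 0 · z^ w · selections (s ∘ suc) (a ∘ suc) m) t
    ≡ selections s a (suc m) t + (z^ w · selections s a (suc m)) t
  selections-suc-+-z^ s a m w t = sym (cong₂ _+_ (selections-suc s a m t) (begin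
    (z^ w · selections s a (suc m)) t
      ≡⟨ z^-cong w t (λ t′ _ → selections-suc s a m t′) ⟩
    (z^ w · [1+z^ s 0 ]^ a 0 · selections (s ∘ suc) (a ∘ suc) m) t
      ≡⟨ [1+z^]-z^ (s 0) (a 0) w (selections (s ∘ suc) (a ∘ suc) m) t ⟨
    ([1+z^ s 0 ]^ a 0 · z^ w · selections (s ∘ suc) (a ∘ suc) m) t ∎))

  selections-increment : ∀ s a m j → j < m → 1 ≤ s j → ∀ t → t ≤ D →
    selections s (λ i → 𝟙 (j ≟ i) + a i) m t ≡ selections s a m t + (z^ s j · selections s a m) t
  selections-increment s a (suc m) zero _ 1≤s₀ t t≤D = begin
    selections s (λ i → 𝟙 (0 ≟ i) + a i) (suc m) t
      ≡⟨ selections-suc s (λ i → 𝟙 (0 ≟ i) + a i) m t ⟩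
    ([1+z^ s 0 ]^ suc (a 0) · T) t
      ≡⟨ [1+z^]-pascal (s 0) (a 0) T t 1≤s₀ t≤D ⟩
    ([1+z^ s 0 ]^ a 0 · T) t + ([1+z^ s 0 ]^ a 0 · z^ s 0 · T) t
      ≡⟨ selections-suc-+-z^ s a m (s 0) t ⟩
    selections s a (suc m) t + (z^ s 0 · selections s a (suc m)) t ∎
    where
    T : Series
    T = selections (s ∘ suc) (a ∘ suc) m
  selections-increment s a (suc m) (suc j) (s≤s j<m) 1≤sⱼ t t≤D = begin
    selections s (λ i → 𝟙 (suc j ≟ i) + a i) (suc m) t
      ≡⟨ selections-suc s (λ i → 𝟙 (suc j ≟ i) + a i) m t ⟩
    ([1+z^ s 0 ]^ a 0 · selections (s ∘ suc) (λ i → 𝟙 (j ≟ i) + a (suc i)) m) t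
      ≡⟨ [1+z^]-cong (s 0) (a 0) t (λ t′ t′≤t →
           selections-increment (s ∘ suc) (a ∘ suc) m j j<m 1≤sⱼ t′ (≤-trans t′≤t t≤D)) ⟩
    ([1+z^ s 0 ]^ a 0 · λ t′ → T t′ + (z^ s (suc j) · T) t′) t
      ≡⟨ [1+z^]-+ (s 0) (a 0) T (z^ s (suc j) · T) t ⟩
    ([1+z^ s 0 ]^ a 0 · T) t + ([1+z^ s 0 ]^ a 0 · z^ s (suc j) · T) t
      ≡⟨ selections-suc-+-z^ s a m (s (suc j)) t ⟩
    selections s a (suc m) t + (z^ s (suc j) · selections s a (suc m)) t ∎
    where
    T : Series
    T = selections (s ∘ suc) (a ∘ suc) m

  selectionsBySize : ∀ {m} → (Fin m → ℕ) → Series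
  selectionsBySize w = selections suc (λ i → occurrences w (suc i)) D

  subsetsOfWeight≡selectionsBySize-∷ : ∀ m (w : Fin (suc m) → ℕ) j → w zero ≡ suc j → ∀ t → t ≤ D →
    (∀ t′ → t′ ≤ D → subsetsOfWeight m (w ∘ suc) t′ ≡ selectionsBySize (w ∘ suc) t′) →
    subsetsOfWeight (suc m) w t ≡ selectionsBySize w t
  subsetsOfWeight≡selectionsBySize-∷ m w j w₀≡ t t≤D IH with j <? D
  ... | yes j<D = begin
    subsetsOfWeight (suc m) w t
      ≡⟨ subsetsOfWeight-suc m w t ⟩
    (z^ w zero · N) t + N t
      ≡⟨ cong₂ _+_ (trans (cong (λ a → (z^ a · N) t) w₀≡)
                          (z^-cong (suc j) t (λ t′ t′≤t → IH t′ (≤-trans t′≤t t≤D))))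
                   (IH t t≤D) ⟩
    (z^ suc j · S) t + S t
      ≡⟨ +-comm ((z^ suc j · S) t) (S t) ⟩
    S t + (z^ suc j · S) t
      ≡⟨ selections-increment suc (λ i → occurrences (w ∘ suc) (suc i)) D j j<D (s≤s z≤n) t t≤D ⟨
    selections suc (λ i → 𝟙 (j ≟ i) + occurrences (w ∘ suc) (suc i)) D t
      ≡⟨ selections-cong suc D t (λ i _ → sym (trans (occurrences-suc w (suc i))
           (cong (λ v → 𝟙 (v ≟ suc i) + occurrences (w ∘ suc) (suc i)) w₀≡))) ⟩
    selectionsBySize w t ∎
    where
    N S : Series
    N = subsetsOfWeight m (w ∘ suc)
    S = selectionsBySize (w ∘ suc)
  ... | no  j≮D = begin
    subsetsOfWeight (suc m) w t
      ≡⟨ subsetsOfWeight-suc m w t ⟩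
    (z^ w zero · N) t + N t
      ≡⟨ cong (_+ N t) (z^-> (w zero) N t t<w₀) ⟩
    N t
      ≡⟨ IH t t≤D ⟩
    selectionsBySize (w ∘ suc) t
      ≡⟨ selections-cong suc D t (λ i i<D → sym (trans (occurrences-suc w (suc i))
           (cong (_+ occurrences (w ∘ suc) (suc i)) (𝟙-no (w zero ≟ suc i) (λ w₀≡1+i →
             <⇒≢ (<-≤-trans i<D (≮⇒≥ j≮D)) (suc-injective (trans (sym w₀≡1+i) w₀≡))))))) ⟩
    selectionsBySize w t ∎
    where
    N : Series
    N = subsetsOfWeight m (w ∘ suc)
    t<w₀ : t < w zero
    t<w₀ = subst (t <_) (sym w₀≡) (s≤s (≤-trans t≤D (≮⇒≥ j≮D)))

  -- Pieces of size > D cannot occur in a subset of weight t ≤ D, so only sizes 1, …, D are tracked.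
  subsetsOfWeight≡selectionsBySize : ∀ m (w : Fin m → ℕ) → (∀ j → 1 ≤ w j) → ∀ t → t ≤ D →
    subsetsOfWeight m w t ≡ selectionsBySize w t
  subsetsOfWeight≡selectionsBySize zero w _ t _ = begin
    subsetsOfWeight zero w t   ≡⟨ count≡∑𝟙 (λ X → subsetWeight w X ≟ t) (allSubsets zero) ⟩
    𝟙 (0 ≟ t) + 0              ≡⟨ +-identityʳ (𝟙 (0 ≟ t)) ⟩
    𝟙 (0 ≟ t)                  ≡⟨ selections-empty suc (λ i → occurrences w (suc i)) D t (λ _ → refl) ⟨
    selectionsBySize w t ∎
  subsetsOfWeight≡selectionsBySize (suc m) w w≥1 t t≤D =
    subsetsOfWeight≡selectionsBySize-∷ m w (pred (w zero))
      (sym (suc-pred (w zero) ⦃ >-nonZero (w≥1 zero) ⦄)) t t≤D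
      (subsetsOfWeight≡selectionsBySize m (w ∘ suc) (w≥1 ∘ suc))

∣tabulate∣ : ∀ {n} (g : Fin n → Bool) → ∣ tabulate g ∣ ≡ ∑[ u ∈ allFin n ] bit (g u)
∣tabulate∣ {zero}  g = refl
∣tabulate∣ {suc n} g = trans (head (g zero)) (sym (∑-allFin-suc n (bit ∘ g)))
  where
  head : ∀ b → ∣ b ∷ tabulate (g ∘ suc) ∣ ≡ bit b + (∑[ u ∈ allFin n ] bit (g (suc u)))
  head true  = cong suc (∣tabulate∣ (g ∘ suc))
  head false = ∣tabulate∣ (g ∘ suc)

∑-fibres : ∀ {m} (xs : List A) (h : A → Fin m) (f : Fin m → ℕ) →
  ∑[ u ∈ xs ] f (h u) ≡ ∑[ j ∈ allFin m ] f j * count (λ u → h u FP.≟ j) xs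
∑-fibres {m = m} xs h f = begin
  ∑[ u ∈ xs ] f (h u)
    ≡⟨ ∑-cong xs (λ u → allFin-enumerates m .sift (h u) f) ⟨
  ∑[ u ∈ xs ] ∑[ j ∈ allFin m ] 𝟙 (j FP.≟ h u) * f j
    ≡⟨ ∑-comm xs (allFin m) _ ⟩
  ∑[ j ∈ allFin m ] ∑[ u ∈ xs ] 𝟙 (j FP.≟ h u) * f j
    ≡⟨ ∑-cong (allFin m) (λ j → ∑-cong xs (λ u →
         trans (cong (_* f j) (𝟙-⇔ (mk⇔ sym sym) (j FP.≟ h u) (h u FP.≟ j))) (*-comm _ (f j)))) ⟩
  ∑[ j ∈ allFin m ] ∑[ u ∈ xs ] f j * 𝟙 (h u FP.≟ j)
    ≡⟨ ∑-cong (allFin m) (λ j →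
         trans (∑-*ˡ xs (f j) _) (cong (f j *_) (sym (count≡∑𝟙 (λ u → h u FP.≟ j) xs)))) ⟩
  ∑[ j ∈ allFin m ] f j * count (λ u → h u FP.≟ j) xs ∎

preimage : ∀ {n m} → (Fin n → Fin m) → Subset m → Subset n
preimage h X = tabulate (λ u → lookup X (h u))

∣preimage∣ : ∀ {n m} (h : Fin n → Fin m) X → ∣ preimage h X ∣ ≡ subsetWeight (blockSize h) X
∣preimage∣ {n} h X =
  trans (∣tabulate∣ (λ u → lookup X (h u))) (∑-fibres (allFin n) h (λ j → bit (lookup X j)))

transpose-invariant : ∀ {n} (g : Fin n → A) {i j} → g i ≡ g j → ∀ y → g (PC.transpose i j y) ≡ g y
transpose-invariant g {i} {j} gi≡gj y with y FP.≟ i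
... | yes refl = sym gi≡gj
... | no _ with y FP.≟ j
...   | yes refl = gi≡gj
...   | no _     = refl

transpose-fixes⇔ : ∀ {n} (a : Subset n) i j → (transpose i j ⋆ a ≡ a) ⇔ (lookup a i ≡ lookup a j)
transpose-fixes⇔ a i j = mk⇔ to from
  where
  swap-j : PC.transpose j i j ≡ i
  swap-j with j FP.≟ j
  ... | yes _   = refl
  ... | no j≢j = contradiction refl j≢j
  to : transpose i j ⋆ a ≡ a → lookup a i ≡ lookup a j
  to fixed = begin
    lookup a i                          ≡⟨ cong (lookup a) swap-j ⟨
    lookup a (PC.transpose j i j)       ≡⟨ VecP.lookup∘tabulate (λ y → lookup a (PC.transpose j i y)) j ⟨
    lookup (transpose i j ⋆ a) j        ≡⟨ cong (λ b → lookup b j) fixed ⟩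
    lookup a j                          ∎
  from : lookup a i ≡ lookup a j → transpose i j ⋆ a ≡ a
  from ai≡aj = trans (VecP.tabulate-cong (transpose-invariant (lookup a) (sym ai≡aj))) (VecP.tabulate∘lookup a)

BlockConstant : ∀ {n m} → (Fin n → Fin m) → Subset n → Set
BlockConstant comp a = ∀ u v → comp u ≡ comp v → lookup a u ≡ lookup a v

preimage-blockConstant : ∀ {n m} (comp : Fin n → Fin m) X → BlockConstant comp (preimage comp X)
preimage-blockConstant comp X u v comp-u≡comp-v = begin
  lookup (preimage comp X) u   ≡⟨ VecP.lookup∘tabulate _ u ⟩
  lookup X (comp u)            ≡⟨ cong (lookup X) comp-u≡comp-v ⟩
  lookup X (comp v)            ≡⟨ VecP.lookup∘tabulate _ v ⟨
  lookup (preimage comp X) v   ∎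

module Components {n m : ℕ} (G : Graph n) (comp : Fin n → Fin m)
  (components : ∀ u v → Reach G u v ⇔ (comp u ≡ comp v))
  (onto : ∀ j → ∃ λ u → comp u ≡ j) where

  representative : Fin m → Fin n
  representative j = proj₁ (onto j)

  blocksOf : Subset n → Subset m
  blocksOf a = tabulate (λ j → lookup a (representative j))

  fixed⇒blockConstant : ∀ a → FixedByEdges G a → BlockConstant comp a
  fixed⇒blockConstant a fixed u v same = along (Equivalence.from (components u v) same)
    where
    along : ∀ {x y} → Reach G x y → lookup a x ≡ lookup a y
    along here           = refl
    along (step e reach) = trans (Equivalence.to (transpose-fixes⇔ a _ _) (fixed _ _ e)) (along reach)

  blockConstant⇒fixed : ∀ a → BlockConstant comp a → FixedByEdges G a
  blockConstant⇒fixed a constant i j e =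
    Equivalence.from (transpose-fixes⇔ a i j) (constant i j (Equivalence.to (components i j) (step e here)))

  blocksOf∘preimage : ∀ X → blocksOf (preimage comp X) ≡ X
  blocksOf∘preimage X = trans
    (VecP.tabulate-cong (λ j →
      trans (VecP.lookup∘tabulate _ (representative j)) (cong (lookup X) (proj₂ (onto j)))))
    (VecP.tabulate∘lookup X)

  preimage∘blocksOf : ∀ a → BlockConstant comp a → preimage comp (blocksOf a) ≡ a
  preimage∘blocksOf a constant = trans
    (VecP.tabulate-cong (λ u → trans (VecP.lookup∘tabulate _ (comp u))
      (constant (representative (comp u)) u (proj₂ (onto (comp u))))))
    (VecP.tabulate∘lookup a)

  good-preimage⇔ : ∀ k X → Good G k (preimage comp X) ⇔ (subsetWeight (blockSize comp) X ≡ k)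
  good-preimage⇔ k X = mk⇔
    (λ (size≡k , _) → trans (sym (∣preimage∣ comp X)) size≡k)
    (λ weight≡k → trans (∣preimage∣ comp X) weight≡k ,
                  blockConstant⇒fixed (preimage comp X) (preimage-blockConstant comp X))

  goodSubsets≡subsetsOfWeight : ∀ k → count (good? G k) (allSubsets n) ≡ subsetsOfWeight m (blockSize comp) k
  goodSubsets≡subsetsOfWeight k = count-bijection (allSubsets-enumerates n) (allSubsets-enumerates m)
    (good? G k) (λ X → subsetWeight (blockSize comp) X ≟ k) (preimage comp) blocksOf
    blocksOf∘preimage (λ a good → preimage∘blocksOf a (fixed⇒blockConstant a (proj₂ good))) (good-preimage⇔ k)

  blockSize-positive : ∀ j → 1 ≤ blockSize comp j
  blockSize-positive j =
    ∈-length (∈-filter⁺ (λ u → comp u FP.≟ j) (∈-allFin (representative j)) (proj₂ (onto j)))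

mult≡occurrences : ∀ {n m} (c : Fin n → ℕ) (w : Fin m → ℕ) →
  (∀ i → c i ≡ occurrences w (suc (toℕ i))) →
  ∀ i → i < n → mult c (suc i) ≡ occurrences w (suc i)
mult≡occurrences {n} c w c≡ i i<n with i <? n
... | yes _   = trans (c≡ (fromℕ< i<n)) (cong (occurrences w ∘ suc) (FP.toℕ-fromℕ< i<n))
... | no  i≮n = contradiction i<n i≮n

lemma2p4 : (n k ℓ : ℕ) → 1 ≤ n → 1 ≤ k → 2 * k ≤ n → 1 ≤ ℓ →
    (c : Fin n → ℕ) → IsPartitionExp n c →
    (G : Graph n) → ComponentsHaveSizes G c →
    f G k ℓ ≡ partitionBinomSum c k ^ ℓ
lemma2p4 n k ℓ _ _ 2k≤n _ c _ G (m , comp , components , onto , sizes) = begin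
  f G k ℓ
    ≡⟨ count-tuples (good? G k) (allSubsets n) ℓ ⟩
  count (good? G k) (allSubsets n) ^ ℓ
    ≡⟨ cong (_^ ℓ) (goodSubsets≡subsetsOfWeight k) ⟩
  subsetsOfWeight m (blockSize comp) k ^ ℓ
    ≡⟨ cong (_^ ℓ) (subsetsOfWeight≡selectionsBySize m (blockSize comp) blockSize-positive k ≤-refl) ⟩
  selectionsBySize (blockSize comp) k ^ ℓ
    ≡⟨ cong (_^ ℓ) (selections-cong suc k k (λ i i<k →
         sym (mult≡occurrences c (blockSize comp) sizes i (<-≤-trans i<k k≤n)))) ⟩
  selections suc (λ i → mult c (suc i)) k k ^ ℓ
    ≡⟨ cong (_^ ℓ) (∑-filter (isPartitionExpV? k) (allVecsUpTo k k) (ways (λ i → mult c (suc i)))) ⟨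
  partitionBinomSum c k ^ ℓ ∎
  where
  open Components G comp components onto
  open Truncated k
  k≤n : k ≤ n
  k≤n = ≤-trans (m≤m+n k (k + 0)) 2k≤n
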